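{- Let $\vec G$ be an oriented graph with at least one leaf. If $u\in V(\vec G)$ is adjacent to $k$ leaves, then every zero forcing set of $\vec G$ contains at least $k-1$ of the leaves adjacent to $u$.
   Context: An oriented graph is a simple digraph with no pair of opposite arcs; a leaf is a vertex of degree $1$ in the underlying undirected graph, and adjacency refers to the underlying graph. Zero forcing: vertices are blue or white; a blue vertex $u$ with exactly one white out-neighbor $w$ may force $w$, turning it blue. $B\subseteq V(\vec G)$ is a zero forcing set if, starting with exactly $B$ blue and repeatedly applying forces, all vertices can become blue. -}

module Defs where

open import Data.Nat using (ℕ; zero; suc)
open import Data.Fin using (Fin; _≟_)
open import Relation.Nullary using (yes; no)
open import Data.Bool using (Bool; true; false; _∧_; _∨_; not)
open import Data.List using (List; length; allFin; filterᵇ)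
open import Data.Product using (Σ; _×_; ∃)
open import Relation.Binary.PropositionalEquality using (_≡_; _≢_)
open import Relation.Binary.Construct.Closure.ReflexiveTransitive using (Star)

-- An oriented graph on the vertex set Fin n: a loopless arc relation
-- (given as a Boolean adjacency matrix, so simple) with no pair of opposite arcs.
record OrientedGraph (n : ℕ) : Set where
  field
    arc       : Fin n → Fin n → Bool
    loopless  : ∀ v → arc v v ≡ false
    no-2cycle : ∀ u v → arc u v ≡ true → arc v u ≡ false
open OrientedGraph public

adj : ∀ {n} → OrientedGraph n → Fin n → Fin n → Bool
adj G u v = arc G u v ∨ arc G v u

degree : ∀ {n} → OrientedGraph n → Fin n → ℕ
degree {n} G v = length (filterᵇ (adj G v) (allFin n))

isOne : ℕ → Bool
isOne (suc zero) = true
isOne _          = false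

isLeaf : ∀ {n} → OrientedGraph n → Fin n → Bool
isLeaf G v = isOne (degree G v)

leavesAt : ∀ {n} → OrientedGraph n → Fin n → List (Fin n)
leavesAt {n} G u = filterᵇ (λ v → adj G u v ∧ isLeaf G v) (allFin n)

-- colourings: B v ≡ true means v is blue
Colouring : ℕ → Set
Colouring n = Fin n → Bool

paint : ∀ {n} → Colouring n → Fin n → Colouring n
paint {n} B w v with v ≟ w
... | yes _ = true
... | no  _ = B v

data Force {n} (G : OrientedGraph n) : Colouring n → Colouring n → Set where
  force : ∀ {B} (u w : Fin n) →
          B u ≡ true →
          arc G u w ≡ true →
          B w ≡ false →
          (∀ x → arc G u x ≡ true → B x ≡ false → x ≡ w) →
          Force G B (paint B w)

IsZeroForcingSet : ∀ {n} → OrientedGraph n → Colouring n → Set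
IsZeroForcingSet {n} G B =
  ∃ λ (F : Colouring n) → Star (Force G) B F × (∀ v → F v ≡ true)

module Submission where

-- Call a vertex v "fed only by u" if u is its only possible
-- in-neighbour.  A leaf adjacent to u is fed only by u, since its unique
-- neighbour in the underlying graph is u.  For two distinct vertices a, b fed
-- only by u, the property
--   Stuck C :  a and b are both white, or one of them is white and is not an
--              out-neighbour of u (so nothing can ever force it)
-- is preserved by every force: only u can force a or b, and while both are
-- white out-neighbours of u, u has two white out-neighbours and forces neither.
-- A zero forcing set ends with everything blue, where Stuck fails; so a zero
-- forcing set cannot leave two vertices fed only by u white.  A counting
-- lemma on duplicate-free lists then shows that among the k leaves adjacent
-- to u at least k - 1 are blue.

open import Defs
open import Data.Nat using (ℕ; zero; suc; _≤_; _∸_; z≤n; s≤s)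
open import Data.Nat.Properties using (≤-refl; ≤-trans)
open import Data.Fin using (Fin; _≟_)
open import Data.Bool using (Bool; true; false; T; T?; _∧_; _∨_)
open import Data.Bool.Properties using (T-≡; T-∧; ∨-zeroʳ; ∨-comm)
open import Data.List using (List; []; _∷_; length; filterᵇ; allFin)
open import Data.List.Membership.Propositional using (_∈_)
open import Data.List.Membership.Propositional.Properties using (∈-allFin; ∈-filter⁺; ∈-filter⁻)
open import Data.List.Relation.Unary.Any using (here; there)
open import Data.List.Relation.Unary.All using (lookup)
open import Data.List.Relation.Unary.AllPairs using ([]; _∷_)
open import Data.List.Relation.Unary.Unique.Propositional using (Unique)
import Data.List.Relation.Unary.Unique.Propositional.Properties as Unique
open import Data.Product using (∃; _×_; _,_; proj₁; proj₂)
open import Data.Sum using (_⊎_; inj₁; inj₂)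
open import Data.Empty using (⊥-elim)
open import Function using (_∘_)
open import Function.Bundles using (Equivalence)
open import Relation.Nullary using (yes; no)
open import Relation.Binary.PropositionalEquality using (_≡_; _≢_; refl; sym; trans; cong)
open import Relation.Binary.Construct.Closure.ReflexiveTransitive using (Star; ε; _◅_)

open Equivalence using (to; from)

true≢false : ∀ {b} → b ≡ true → b ≡ false → ∀ {A : Set} → A
true≢false refl ()

∈-filterᵇ⁺ : ∀ {A : Set} (p : A → Bool) {x xs} → x ∈ xs → p x ≡ true → x ∈ filterᵇ p xs
∈-filterᵇ⁺ p x∈xs px = ∈-filter⁺ (T? ∘ p) x∈xs (from T-≡ px)

∈-filterᵇ⁻ : ∀ {A : Set} (p : A → Bool) {x} xs → x ∈ filterᵇ p xs → p x ≡ true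
∈-filterᵇ⁻ p xs x∈ = to T-≡ (proj₂ (∈-filter⁻ (T? ∘ p) {xs = xs} x∈))

∈-singleton-unique : ∀ {A : Set} {xs : List A} {x y} → length xs ≡ 1 → x ∈ xs → y ∈ xs → x ≡ y
∈-singleton-unique {xs = _ ∷ []} refl (here refl) (here refl) = refl

isOne⇒≡1 : ∀ m → isOne m ≡ true → m ≡ 1
isOne⇒≡1 (suc zero) _ = refl

module _ {n} (G : OrientedGraph n) where

  -- u is the only vertex that could ever force v.
  FedOnlyBy : Fin n → Fin n → Set
  FedOnlyBy u v = ∀ x → arc G x v ≡ true → x ≡ u

  -- A leaf adjacent to u is fed only by u: every in-neighbour is a neighbour,
  -- and a leaf has exactly one neighbour.
  leaf-fedOnlyBy : ∀ {u ℓ} → isLeaf G ℓ ≡ true → adj G u ℓ ≡ true → FedOnlyBy u ℓ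
  leaf-fedOnlyBy {u} {ℓ} leaf uℓ x xℓ =
    ∈-singleton-unique (isOne⇒≡1 (degree G ℓ) leaf) (neighbour x xℓ-adj) (neighbour u ℓu-adj)
    where
      neighbour : ∀ v → adj G ℓ v ≡ true → v ∈ filterᵇ (adj G ℓ) (allFin n)
      neighbour v = ∈-filterᵇ⁺ (adj G ℓ) (∈-allFin v)
      xℓ-adj : adj G ℓ x ≡ true
      xℓ-adj = trans (cong (arc G ℓ x ∨_) xℓ) (∨-zeroʳ (arc G ℓ x))
      ℓu-adj : adj G ℓ u ≡ true
      ℓu-adj = trans (∨-comm (arc G ℓ u) (arc G u ℓ)) uℓ

  leavesAt-fedOnlyBy : ∀ {u ℓ} → ℓ ∈ leavesAt G u → FedOnlyBy u ℓ
  leavesAt-fedOnlyBy {u} {ℓ} ℓ∈ =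
    leaf-fedOnlyBy (to T-≡ (proj₂ both)) (to T-≡ (proj₁ both))
    where
      both : T (adj G u ℓ) × T (isLeaf G ℓ)
      both = to T-∧ (from T-≡ (∈-filterᵇ⁻ (λ v → adj G u v ∧ isLeaf G v) (allFin n) ℓ∈))

  paint-cases : ∀ (C : Colouring n) w v → v ≡ w ⊎ paint C w v ≡ C v
  paint-cases C w v with v ≟ w
  ... | yes v≡w = inj₁ v≡w
  ... | no _ = inj₂ refl

  module _ (u : Fin n) where

    -- v is white and can never be forced, since its only possible forcer u
    -- has no arc to it.
    Frozen : Colouring n → Fin n → Set
    Frozen C v = C v ≡ false × arc G u v ≡ false

    Stuck : Colouring n → Fin n → Fin n → Set
    Stuck C a b = (C a ≡ false × C b ≡ false) ⊎ Frozen C a ⊎ Frozen C b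

    forced-by-u : ∀ {a} → FedOnlyBy u a → ∀ {x} → arc G x a ≡ true → arc G u a ≡ true
    forced-by-u fed {x} xa with fed x xa
    ... | refl = xa

    frozen-preserved : ∀ {C C' a} → FedOnlyBy u a → Force G C C' → Frozen C a → Frozen C' a
    frozen-preserved {a = a} fed (force {C} x w _ xw _ _) (Ca , ua) with paint-cases C w a
    ... | inj₁ refl = true≢false (forced-by-u fed xw) ua
    ... | inj₂ same = trans same Ca , ua

    -- If u forces a while b is white, then b is not an out-neighbour of u:
    -- otherwise u would have the two white out-neighbours a and b.
    forcing-a-freezes-b : ∀ {C : Colouring n} {x a b} → FedOnlyBy u a → a ≢ b → C b ≡ false →
      arc G x a ≡ true → (∀ y → arc G x y ≡ true → C y ≡ false → y ≡ a) → arc G u b ≡ false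
    forcing-a-freezes-b {C} {x} {a} {b} fed a≢b Cb xa unique with fed x xa | arc G u b in ub
    ... | refl | true = ⊥-elim (a≢b (sym (unique b ub Cb)))
    ... | refl | false = refl

    both-white-step : ∀ {C C' a b} → FedOnlyBy u a → FedOnlyBy u b → a ≢ b →
      Force G C C' → C a ≡ false → C b ≡ false → Stuck C' a b
    both-white-step {a = a} {b} feda fedb a≢b (force {C} x w _ xw _ unique) Ca Cb
      with paint-cases C w a | paint-cases C w b
    ... | inj₁ refl | inj₁ refl = ⊥-elim (a≢b refl)
    ... | inj₁ refl | inj₂ same-b =
      inj₂ (inj₂ (trans same-b Cb , forcing-a-freezes-b {C} feda a≢b Cb xw unique))
    ... | inj₂ same-a | inj₁ refl =
      inj₂ (inj₁ (trans same-a Ca , forcing-a-freezes-b {C} fedb (a≢b ∘ sym) Ca xw unique))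
    ... | inj₂ same-a | inj₂ same-b = inj₁ (trans same-a Ca , trans same-b Cb)

    stuck-step : ∀ {C C' a b} → FedOnlyBy u a → FedOnlyBy u b → a ≢ b →
      Force G C C' → Stuck C a b → Stuck C' a b
    stuck-step feda fedb a≢b f (inj₁ (Ca , Cb)) = both-white-step feda fedb a≢b f Ca Cb
    stuck-step feda fedb a≢b f (inj₂ (inj₁ fa)) = inj₂ (inj₁ (frozen-preserved feda f fa))
    stuck-step feda fedb a≢b f (inj₂ (inj₂ fb)) = inj₂ (inj₂ (frozen-preserved fedb f fb))

    stuck-preserved : ∀ {C F a b} → FedOnlyBy u a → FedOnlyBy u b → a ≢ b →
      Star (Force G) C F → Stuck C a b → Stuck F a b
    stuck-preserved feda fedb a≢b ε s = s
    stuck-preserved feda fedb a≢b (f ◅ fs) s =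
      stuck-preserved feda fedb a≢b fs (stuck-step feda fedb a≢b f s)

    zfs-one-white : ∀ {B} → IsZeroForcingSet G B → ∀ {a b} →
      FedOnlyBy u a → FedOnlyBy u b → a ≢ b → B a ≡ false → B b ≡ false → ∀ {A : Set} → A
    zfs-one-white (F , forces , allBlue) feda fedb a≢b Ba Bb
      with stuck-preserved feda fedb a≢b forces (inj₁ (Ba , Bb))
    ... | inj₁ (Fa , _) = true≢false (allBlue _) Fa
    ... | inj₂ (inj₁ (Fa , _)) = true≢false (allBlue _) Fa
    ... | inj₂ (inj₂ (Fb , _)) = true≢false (allBlue _) Fb

filterᵇ-all : ∀ {A : Set} (B : A → Bool) (ys : List A) → (∀ {y} → y ∈ ys → B y ≡ true) →
  length ys ≤ length (filterᵇ B ys)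
filterᵇ-all B [] _ = z≤n
filterᵇ-all B (y ∷ ys) blue with B y in By
... | true = s≤s (filterᵇ-all B ys (blue ∘ there))
... | false = true≢false (blue (here refl)) By

-- Truncated predecessor: m ≤ 1 + (m ∸ 1) also for m = 0.
m≤1+[m∸1] : ∀ m → m ≤ suc (m ∸ 1)
m≤1+[m∸1] zero = z≤n
m≤1+[m∸1] (suc m) = ≤-refl

not-false⇒true : ∀ {b} → (b ≡ false → ∀ {A : Set} → A) → b ≡ true
not-false⇒true {true} _ = refl
not-false⇒true {false} absurd = absurd refl

all-but-one-blue : ∀ {A : Set} (B : A → Bool) (xs : List A) → Unique xs →
  (∀ {a b} → a ∈ xs → b ∈ xs → a ≢ b → B a ≡ false → B b ≡ false → ∀ {C : Set} → C) →
  length xs ∸ 1 ≤ length (filterᵇ B xs)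
all-but-one-blue B [] _ _ = z≤n
all-but-one-blue B (y ∷ ys) (y∉ys ∷ uniq) twoWhite with B y in By
... | true = ≤-trans (m≤1+[m∸1] (length ys))
               (s≤s (all-but-one-blue B ys uniq (λ a∈ b∈ → twoWhite (there a∈) (there b∈))))
... | false = filterᵇ-all B ys (λ z∈ → not-false⇒true
                (twoWhite (here refl) (there z∈) (lookup y∉ys z∈) By))

proposition3p9 : ∀ {n} (G : OrientedGraph n) →
    (∃ λ (ℓ : Fin n) → isLeaf G ℓ ≡ true) →
    (u : Fin n) (k : ℕ) → length (leavesAt G u) ≡ k →
    (B : Colouring n) → IsZeroForcingSet G B →
    k ∸ 1 ≤ length (filterᵇ B (leavesAt G u))
proposition3p9 {n} G _ u k refl B zfs =
  all-but-one-blue B (leavesAt G u) leaves-distinct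
    (λ a∈ b∈ → zfs-one-white G u zfs (leavesAt-fedOnlyBy G a∈) (leavesAt-fedOnlyBy G b∈))
  where
    leaves-distinct : Unique (leavesAt G u)
    leaves-distinct = Unique.filter⁺ (T? ∘ λ v → adj G u v ∧ isLeaf G v) (Unique.allFin⁺ n)
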